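{- For positive integers $a_1,\dots,a_k$ and $n\in\mathbb{N}$, let $N(a_1,\dots,a_k;n)=\#\{(x_1,\dots,x_k)\in\mathbb{Z}^k : n=\sum_{i=1}^k a_i x_i^2\}$ and $T(a_1,\dots,a_k;n)=\#\{(x_1,\dots,x_k)\in\mathbb{N}^k : n=\sum_{i=1}^k a_i \tfrac{x_i(x_i+1)}{2}\}$. Let $n\in\mathbb{Z}^+$. Then $$16\,T(3,7,15;n)=3N(3,7,15;8n+25)-N\big(3,7,15;4(8n+25)\big).$$
   Context: $\mathbb{N}$ denotes the set of non-negative integers and $\mathbb{Z}^+$ the set of positive integers. $N(a_1,\dots,a_k;n)$ counts representations of $n$ by the diagonal quadratic form $\sum a_i x_i^2$ with integer $x_i$; $T(a_1,\dots,a_k;n)$ counts representations of $n$ as $\sum a_i t_i$ where each $t_i=x_i(x_i+1)/2$ with $x_i\ge 0$. -}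

module Defs where

open import Data.Nat using (ℕ; zero; suc; _+_; _*_; _∸_; _/_)
open import Data.Nat.Properties using (_≟_)
open import Data.Integer as ℤ using (ℤ; +_; -[1+_])
open import Data.List using (List; []; _∷_; _++_; length; filter; cartesianProduct; upTo)
open import Data.Product using (_×_; _,_)
open import Relation.Nullary.Decidable using (does)

intRange : ℕ → List ℤ
intRange zero    = + 0 ∷ []
intRange (suc B) = + suc B ∷ -[1+ B ] ∷ intRange B

natRange : ℕ → List ℕ
natRange B = upTo (suc B)

sq : ℤ → ℕ
sq x = ℤ.∣ x ∣ * ℤ.∣ x ∣

tri : ℕ → ℕ
tri x = (x * suc x) / 2

triples : {A : Set} → List A → List (A × A × A)
triples xs = cartesianProduct xs (cartesianProduct xs xs)

-- N(a,b,c;n) = #{(x,y,z) ∈ ℤ³ : n = a x² + b y² + c z²}.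
-- For positive a,b,c every solution has |x|,|y|,|z| ≤ n, so enumerating
-- the box [-n,n]³ counts all solutions (each exactly once).
N₃ : ℕ → ℕ → ℕ → ℕ → ℕ
N₃ a b c n = length (filter (λ { (x , y , z) → a * sq x + b * sq y + c * sq z ≟ n })
                            (triples (intRange n)))

-- T(a,b,c;n) = #{(x,y,z) ∈ ℕ³ : n = a t_x + b t_y + c t_z}.
-- For positive a,b,c every solution has x,y,z ≤ n (since t_x ≥ x).
T₃ : ℕ → ℕ → ℕ → ℕ → ℕ
T₃ a b c n = length (filter (λ { (x , y , z) → a * tri x + b * tri y + c * tri z ≟ n })
                            (triples (natRange n)))

module Submission where

-- Every coefficient of Q = 3x² + 7y² + 15z² is ≡ -1 (mod 4), so Q ≡ -(number of odd coordinates) (mod 4).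
-- Hence all solutions of Q = 4m are even, and halving them gives N(4m) = N(m); all solutions of
-- Q = 8n + 25 are odd, and since (2a+1)² = 8t_a + 1, the map (±(2a+1), ±(2b+1), ±(2c+1)) ↦ (a, b, c) is
-- 8-to-1 onto the solutions of 3t_a + 7t_b + 15t_c = n, so N(8n+25) = 8T(n). Therefore
-- 3N(8n+25) - N(4(8n+25)) = 2N(8n+25) = 16T(n), for every n ≥ 0.

open import Defs

module RepresentationCounts where
  open import Data.Empty using (⊥-elim)
  import Data.Integer as ℤ
  open import Data.List using (List; []; _∷_; _++_; [_]; map; length; filter; cartesianProduct; upTo)
  open import Data.List.Properties using (map-++; map-cong; map-∘; upTo-∷ʳ)
  open import Data.Nat
  open import Data.Nat.DivMod using (m*n/n≡m; +-distrib-/-∣ʳ)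
  open import Data.Nat.Divisibility
    using (_∣_; divides; ∣m∣n⇒∣m+n; ∣m+n∣m⇒∣n; m∣m*n; n∣m*n; ∣⇒≤; >⇒∤)
  open import Data.Nat.ListAction using (sum)
  open import Data.Nat.ListAction.Properties using (sum-++)
  open import Data.Nat.Properties
  open import Data.Nat.Tactic.RingSolver using (solve-∀)
  open import Data.Product using (_×_; _,_; proj₁; proj₂; ∃-syntax)
  open import Function using (_∘_)
  open import Relation.Binary.PropositionalEquality
    using (_≡_; _≢_; refl; sym; trans; cong; cong₂; subst; module ≡-Reasoning)
  open import Relation.Nullary using (Dec; yes; no; ¬_)
  open import Relation.Nullary.Decidable using (decidable-stable)
  open import Relation.Unary using (Decidable)
  open ≡-Reasoning

  𝟙 : {P : Set} → Dec P → ℕ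
  𝟙 (yes _) = 1
  𝟙 (no _)  = 0

  1[_≡_] : ℕ → ℕ → ℕ
  1[ x ≡ y ] = 𝟙 (x ≟ y)

  1[≡]≢0⇒≡ : ∀ {x y} → 1[ x ≡ y ] ≢ 0 → x ≡ y
  1[≡]≢0⇒≡ {x} {y} with x ≟ y
  ... | yes x≡y = λ _ → x≡y
  ... | no _    = λ ≢0 → ⊥-elim (≢0 refl)

  1[≡]-cong : ∀ {x y x′ y′} → (x ≡ y → x′ ≡ y′) → (x′ ≡ y′ → x ≡ y) → 1[ x ≡ y ] ≡ 1[ x′ ≡ y′ ]
  1[≡]-cong {x} {y} {x′} {y′} ⇒ ⇐ with x ≟ y | x′ ≟ y′
  ... | yes _   | yes _    = refl
  ... | no _    | no _     = refl
  ... | yes x≡y | no x′≢y′ = ⊥-elim (x′≢y′ (⇒ x≡y))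
  ... | no x≢y  | yes x′≡y′ = ⊥-elim (x≢y (⇐ x′≡y′))

  length-filter≡sum-𝟙 : {A : Set} {P : A → Set} (P? : Decidable P) (xs : List A) →
                        length (filter P? xs) ≡ sum (map (𝟙 ∘ P?) xs)
  length-filter≡sum-𝟙 P? []       = refl
  length-filter≡sum-𝟙 P? (x ∷ xs) with P? x
  ... | yes _ = cong suc (length-filter≡sum-𝟙 P? xs)
  ... | no _  = length-filter≡sum-𝟙 P? xs

  sum-map-cartesianProduct : {A B : Set} (f : A × B → ℕ) (xs : List A) (ys : List B) →
    sum (map f (cartesianProduct xs ys)) ≡ sum (map (λ x → sum (map (λ y → f (x , y)) ys)) xs)
  sum-map-cartesianProduct f []       ys = refl
  sum-map-cartesianProduct f (x ∷ xs) ys = begin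
    sum (map f (map (x ,_) ys ++ cartesianProduct xs ys))
      ≡⟨ cong sum (map-++ f (map (x ,_) ys) _) ⟩
    sum (map f (map (x ,_) ys) ++ map f (cartesianProduct xs ys))
      ≡⟨ sum-++ (map f (map (x ,_) ys)) _ ⟩
    sum (map f (map (x ,_) ys)) + sum (map f (cartesianProduct xs ys))
      ≡⟨ cong₂ _+_ (cong sum (sym (map-∘ ys))) (sum-map-cartesianProduct f xs ys) ⟩
    sum (map (λ y → f (x , y)) ys) + sum (map (λ x → sum (map (λ y → f (x , y)) ys)) xs) ∎

  sum-map-zero : {A : Set} {f : A → ℕ} (xs : List A) → (∀ x → f x ≡ 0) → sum (map f xs) ≡ 0
  sum-map-zero []       _  = refl
  sum-map-zero (x ∷ xs) f≡0 = cong₂ _+_ (f≡0 x) (sum-map-zero xs f≡0)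

  sum-map-*ˡ : {A : Set} (c : ℕ) (f : A → ℕ) (xs : List A) →
               sum (map (λ x → c * f x) xs) ≡ c * sum (map f xs)
  sum-map-*ˡ c f []       = sym (*-zeroʳ c)
  sum-map-*ˡ c f (x ∷ xs) =
    trans (cong (c * f x +_) (sum-map-*ˡ c f xs)) (sym (*-distribˡ-+ c (f x) _))

  Summation : Set → Set
  Summation A = (A → ℕ) → ℕ

  Extensional : {A : Set} → Summation A → Set
  Extensional {A} F = {h h′ : A → ℕ} → (∀ x → h x ≡ h′ x) → F h ≡ F h′

  sumOver : {A : Set} → List A → Summation A
  sumOver xs h = sum (map h xs)

  sumOver-ext : {A : Set} (xs : List A) → Extensional (sumOver xs)
  sumOver-ext xs h≗h′ = cong sum (map-cong h≗h′ xs)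

  triple : {A : Set} → Summation A → (A → A → A → ℕ) → ℕ
  triple F g = F λ x → F λ y → F λ z → g x y z

  triple-cong : {A : Set} {F : Summation A} {g g′ : A → A → A → ℕ} → Extensional F →
                (∀ x y z → g x y z ≡ g′ x y z) → triple F g ≡ triple F g′
  triple-cong F-ext g≗g′ = F-ext λ x → F-ext λ y → F-ext λ z → g≗g′ x y z

  triple-scale : ∀ k {A : Set} (xs : List A) g →
                 triple (λ h → k * sumOver xs h) g ≡ k * (k * (k * triple (sumOver xs) g))
  triple-scale k xs g = begin
    k * sumOver xs (λ x → k * sumOver xs (λ y → k * sumOver xs (g x y)))
      ≡⟨ cong (k *_) (sumOver-ext xs λ x → cong (k *_) (sum-map-*ˡ k _ xs)) ⟩
    k * sumOver xs (λ x → k * (k * sumOver xs (λ y → sumOver xs (g x y))))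
      ≡⟨ cong (k *_) (sum-map-*ˡ k _ xs) ⟩
    k * (k * sumOver xs (λ x → k * sumOver xs (λ y → sumOver xs (g x y))))
      ≡⟨ cong (λ s → k * (k * s)) (sum-map-*ˡ k _ xs) ⟩
    k * (k * (k * triple (sumOver xs) g)) ∎

  length-filter-triples : {A : Set} {P : A × A × A → Set} (P? : Decidable P) (xs : List A) →
    length (filter P? (triples xs)) ≡ triple (sumOver xs) (λ x y z → 𝟙 (P? (x , y , z)))
  length-filter-triples P? xs = begin
    length (filter P? (triples xs))
      ≡⟨ length-filter≡sum-𝟙 P? (triples xs) ⟩
    sum (map (𝟙 ∘ P?) (cartesianProduct xs (cartesianProduct xs xs)))
      ≡⟨ sum-map-cartesianProduct (𝟙 ∘ P?) xs _ ⟩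
    sumOver xs (λ x → sumOver (cartesianProduct xs xs) (λ yz → 𝟙 (P? (x , yz))))
      ≡⟨ sumOver-ext xs (λ x → sum-map-cartesianProduct (λ yz → 𝟙 (P? (x , yz))) xs xs) ⟩
    triple (sumOver xs) (λ x y z → 𝟙 (P? (x , y , z))) ∎

  triple-reduce : {A : Set} {F G : Summation A} (P : A → Set) {g : A → A → A → ℕ} →
    Extensional F → Extensional G → G (λ _ → 0) ≡ 0 →
    (∀ h → (∀ x → ¬ P x → h x ≡ 0) → F h ≡ G h) →
    (∀ x y z → g x y z ≢ 0 → P x × P y × P z) →
    triple F g ≡ triple G g
  triple-reduce {A} {F} {G} P {g} F-ext G-ext G0 reduce support =
    trans (F-ext λ x → trans (F-ext λ y → reduce (g x y) (λ z ¬Pz → vanish (¬Pz ∘ proj₂ ∘ proj₂)))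
                             (reduce _ λ y ¬Py → G-zero λ z → vanish (¬Py ∘ proj₁ ∘ proj₂)))
          (reduce _ λ x ¬Px → G-zero λ y → G-zero λ z → vanish (¬Px ∘ proj₁))
    where
    vanish : ∀ {x y z} → ¬ (P x × P y × P z) → g x y z ≡ 0
    vanish ¬P = decidable-stable (_ ≟ 0) (¬P ∘ support _ _ _)
    G-zero : {h : A → ℕ} → (∀ x → h x ≡ 0) → G h ≡ 0
    G-zero h≡0 = trans (G-ext h≡0) G0

  ∑ℤ : ℕ → Summation ℕ
  ∑ℤ B h = sumOver (intRange B) (λ x → h ℤ.∣ x ∣)

  ∑ℕ : ℕ → Summation ℕ
  ∑ℕ K = sumOver (natRange K)

  ∑ℤ-ext : ∀ B → Extensional (∑ℤ B)
  ∑ℤ-ext B h≗h′ = sumOver-ext (intRange B) (h≗h′ ∘ ℤ.∣_∣)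

  ∑ℤ-zero : ∀ B → ∑ℤ B (λ _ → 0) ≡ 0
  ∑ℤ-zero B = sum-map-zero (intRange B) (λ _ → refl)

  ∑ℕ-zero : ∀ K → ∑ℕ K (λ _ → 0) ≡ 0
  ∑ℕ-zero K = sum-map-zero (natRange K) (λ _ → refl)

  ∑ℕ-suc : ∀ K h → ∑ℕ (suc K) h ≡ ∑ℕ K h + h (suc K)
  ∑ℕ-suc K h = begin
    sum (map h (upTo (suc (suc K))))              ≡⟨ cong (sum ∘ map h) (upTo-∷ʳ (suc K)) ⟨
    sum (map h (upTo (suc K) ++ [ suc K ]))      ≡⟨ cong sum (map-++ h (upTo (suc K)) _) ⟩
    sum (map h (upTo (suc K)) ++ [ h (suc K) ])   ≡⟨ sum-++ (map h (upTo (suc K))) _ ⟩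
    ∑ℕ K h + (h (suc K) + 0)                      ≡⟨ cong (∑ℕ K h +_) (+-identityʳ _) ⟩
    ∑ℕ K h + h (suc K)                            ∎

  ∑ℤ-truncate : ∀ {K B} h → K ≤ B → (∀ u → K < u → h u ≡ 0) → ∑ℤ B h ≡ ∑ℤ K h
  ∑ℤ-truncate {K} h K≤B vanish = go (≤⇒≤′ K≤B)
    where
    go : ∀ {B} → K ≤′ B → ∑ℤ B h ≡ ∑ℤ K h
    go ≤′-refl             = refl
    go (≤′-step {B} K≤′B) rewrite vanish (suc B) (s≤s (≤′⇒≤ K≤′B)) = go K≤′B

  ∑ℤ-split : ∀ K h → ∑ℤ (1 + 2 * K) h ≡ ∑ℤ K (λ a → h (2 * a)) + 2 * ∑ℕ K (λ a → h (1 + 2 * a))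
  ∑ℤ-split zero    h = ring (h 0) (h 1)
    where
    ring : ∀ x y → y + (y + (x + 0)) ≡ (x + 0) + 2 * (y + 0)
    ring = solve-∀
  ∑ℤ-split (suc K) h = begin
    ∑ℤ (1 + 2 * suc K) h
      ≡⟨ cong (λ B → ∑ℤ (suc B) h) (*-suc 2 K) ⟩
    odd₊ + (odd₊ + (even₊ + (even₊ + ∑ℤ (1 + 2 * K) h)))
      ≡⟨ cong (λ s → odd₊ + (odd₊ + (even₊ + (even₊ + s)))) (∑ℤ-split K h) ⟩
    odd₊ + (odd₊ + (even₊ + (even₊ + (evens + 2 * odds))))
      ≡⟨ ring odd₊ even₊ evens odds ⟩
    (even₊ + (even₊ + evens)) + 2 * (odds + odd₊)
      ≡⟨ cong₂ (λ e s → (e + (e + evens)) + 2 * s) (cong h (sym (*-suc 2 K)))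
               (trans (cong (odds +_) (cong (λ B → h (suc B)) (sym (*-suc 2 K))))
                      (sym (∑ℕ-suc K (λ a → h (1 + 2 * a))))) ⟩
    ∑ℤ (suc K) (λ a → h (2 * a)) + 2 * ∑ℕ (suc K) (λ a → h (1 + 2 * a)) ∎
    where
    odd₊ even₊ evens odds : ℕ
    odd₊  = h (3 + 2 * K)
    even₊ = h (2 + 2 * K)
    evens = ∑ℤ K (λ a → h (2 * a))
    odds  = ∑ℕ K (λ a → h (1 + 2 * a))
    ring : ∀ o e E O → o + (o + (e + (e + (E + 2 * O)))) ≡ (e + (e + E)) + 2 * (O + o)
    ring = solve-∀

  EvenUpTo : ℕ → ℕ → Set
  EvenUpTo K u = ∃[ a ] a ≤ K × u ≡ 2 * a

  OddUpTo : ℕ → ℕ → Set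
  OddUpTo K u = ∃[ a ] a ≤ K × u ≡ 1 + 2 * a

  ∑ℤ-evens : ∀ {K B} h → 1 + 2 * K ≤ B → (∀ u → ¬ EvenUpTo K u → h u ≡ 0) →
             ∑ℤ B h ≡ ∑ℤ K (λ a → h (2 * a))
  ∑ℤ-evens {K} {B} h 1+2K≤B vanish = begin
    ∑ℤ B h            ≡⟨ ∑ℤ-truncate h 1+2K≤B beyond ⟩
    ∑ℤ (1 + 2 * K) h  ≡⟨ ∑ℤ-split K h ⟩
    evens + 2 * odds  ≡⟨ cong (λ s → evens + 2 * s) odds≡0 ⟩
    evens + 0         ≡⟨ +-identityʳ evens ⟩
    evens             ∎
    where
    evens odds : ℕ
    evens = ∑ℤ K (λ a → h (2 * a))
    odds  = ∑ℕ K (λ a → h (1 + 2 * a))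
    beyond : ∀ u → 1 + 2 * K < u → h u ≡ 0
    beyond u 1+2K<u = vanish u λ { (a , a≤K , refl) → <⇒≱ 1+2K<u (≤-trans (*-monoʳ-≤ 2 a≤K) (n≤1+n _)) }
    odds≡0 : odds ≡ 0
    odds≡0 = trans (sumOver-ext (natRange K) λ a → vanish _ λ { (b , _ , e) → even≢odd b a (sym e) })
                   (∑ℕ-zero K)

  ∑ℤ-odds : ∀ {K B} h → 1 + 2 * K ≤ B → (∀ u → ¬ OddUpTo K u → h u ≡ 0) →
            ∑ℤ B h ≡ 2 * ∑ℕ K (λ a → h (1 + 2 * a))
  ∑ℤ-odds {K} {B} h 1+2K≤B vanish = begin
    ∑ℤ B h            ≡⟨ ∑ℤ-truncate h 1+2K≤B beyond ⟩
    ∑ℤ (1 + 2 * K) h  ≡⟨ ∑ℤ-split K h ⟩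
    evens + 2 * odds  ≡⟨ cong (_+ 2 * odds) evens≡0 ⟩
    2 * odds          ∎
    where
    evens odds : ℕ
    evens = ∑ℤ K (λ a → h (2 * a))
    odds  = ∑ℕ K (λ a → h (1 + 2 * a))
    beyond : ∀ u → 1 + 2 * K < u → h u ≡ 0
    beyond u 1+2K<u = vanish u λ { (a , a≤K , refl) → <⇒≱ 1+2K<u (s≤s (*-monoʳ-≤ 2 a≤K)) }
    evens≡0 : evens ≡ 0
    evens≡0 = trans (∑ℤ-ext K λ a → vanish _ λ { (b , _ , e) → even≢odd a b e }) (∑ℤ-zero K)

  linForm : ℕ → ℕ → ℕ → ℕ → ℕ → ℕ → ℕ
  linForm a b c x y z = a * x + b * y + c * z

  diagForm : ℕ → ℕ → ℕ → ℕ → ℕ → ℕ → ℕ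
  diagForm a b c u v w = linForm a b c (u * u) (v * v) (w * w)

  linForm-bounds : ∀ {a b c x y z m} .{{_ : NonZero a}} .{{_ : NonZero b}} .{{_ : NonZero c}} →
                   linForm a b c x y z ≡ m → x ≤ m × y ≤ m × z ≤ m
  linForm-bounds {a} {b} {c} {x} {y} {z} refl =
      ≤-trans (m≤n*m x a) (≤-trans (m≤m+n (a * x) (b * y)) (m≤m+n _ (c * z)))
    , ≤-trans (m≤n*m y b) (≤-trans (m≤n+m (b * y) (a * x)) (m≤m+n _ (c * z)))
    , ≤-trans (m≤n*m z c) (m≤n+m (c * z) (a * x + b * y))

  n≤n*n : ∀ n → n ≤ n * n
  n≤n*n zero    = z≤n
  n≤n*n (suc n) = m≤m*n (suc n) (suc n)

  diagForm-bounds : ∀ {a b c u v w m} .{{_ : NonZero a}} .{{_ : NonZero b}} .{{_ : NonZero c}} →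
                    diagForm a b c u v w ≡ m → u ≤ m × v ≤ m × w ≤ m
  diagForm-bounds {u = u} {v} {w} eq with linForm-bounds eq
  ... | u²≤m , v²≤m , w²≤m = ≤-trans (n≤n*n u) u²≤m , ≤-trans (n≤n*n v) v²≤m , ≤-trans (n≤n*n w) w²≤m

  tri-suc : ∀ n → tri (suc n) ≡ tri n + suc n
  tri-suc n = begin
    (suc n * suc (suc n)) / 2     ≡⟨ cong (_/ 2) (ring n) ⟩
    (n * suc n + suc n * 2) / 2   ≡⟨ +-distrib-/-∣ʳ (n * suc n) (n∣m*n (suc n)) ⟩
    tri n + suc n * 2 / 2         ≡⟨ cong (tri n +_) (m*n/n≡m (suc n) 2) ⟩
    tri n + suc n                 ∎
    where
    ring : ∀ n → suc n * suc (suc n) ≡ n * suc n + suc n * 2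
    ring = solve-∀

  n≤tri : ∀ n → n ≤ tri n
  n≤tri zero    = z≤n
  n≤tri (suc n) = subst (suc n ≤_) (sym (tri-suc n)) (m≤n+m (suc n) (tri n))

  odd-square : ∀ n → (1 + 2 * n) * (1 + 2 * n) ≡ 8 * tri n + 1
  odd-square zero    = refl
  odd-square (suc n) = begin
    (1 + 2 * suc n) * (1 + 2 * suc n)      ≡⟨ step n ⟩
    (1 + 2 * n) * (1 + 2 * n) + 8 * suc n  ≡⟨ cong (_+ 8 * suc n) (odd-square n) ⟩
    8 * tri n + 1 + 8 * suc n              ≡⟨ regroup (tri n) n ⟩
    8 * (tri n + suc n) + 1                ≡⟨ cong (λ t → 8 * t + 1) (tri-suc n) ⟨
    8 * tri (suc n) + 1                    ∎
    where
    step : ∀ n → (1 + 2 * suc n) * (1 + 2 * suc n) ≡ (1 + 2 * n) * (1 + 2 * n) + 8 * suc n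
    step = solve-∀
    regroup : ∀ t n → 8 * t + 1 + 8 * suc n ≡ 8 * (t + suc n) + 1
    regroup = solve-∀

  diagForm-double : ∀ a b c u v w → diagForm a b c (2 * u) (2 * v) (2 * w) ≡ 4 * diagForm a b c u v w
  diagForm-double = ring
    where
    ring : ∀ a b c u v w → a * (2 * u * (2 * u)) + b * (2 * v * (2 * v)) + c * (2 * w * (2 * w)) ≡
                          4 * (a * (u * u) + b * (v * v) + c * (w * w))
    ring = solve-∀

  diagForm-odd : ∀ a b c u v w → diagForm a b c (1 + 2 * u) (1 + 2 * v) (1 + 2 * w) ≡
                                 8 * linForm a b c (tri u) (tri v) (tri w) + (a + b + c)
  diagForm-odd a b c u v w rewrite odd-square u | odd-square v | odd-square w =
    ring a b c (tri u) (tri v) (tri w)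
    where
    ring : ∀ a b c x y z → a * (8 * x + 1) + b * (8 * y + 1) + c * (8 * z + 1) ≡
                          8 * (a * x + b * y + c * z) + (a + b + c)
    ring = solve-∀

  data EvenOrOdd : ℕ → Set where
    even : ∀ a → EvenOrOdd (2 * a)
    odd  : ∀ a → EvenOrOdd (1 + 2 * a)

  evenOrOdd : ∀ n → EvenOrOdd n
  evenOrOdd zero = even 0
  evenOrOdd (suc n) with evenOrOdd n
  ... | even a = odd a
  ... | odd a  = subst EvenOrOdd (*-suc 2 a) (even (suc a))

  oddness : ∀ {n} → EvenOrOdd n → ℕ
  oddness (even _) = 0
  oddness (odd _)  = 1

  oddness≤1 : ∀ {n} (p : EvenOrOdd n) → oddness p ≤ 1
  oddness≤1 (even _) = z≤n
  oddness≤1 (odd _)  = s≤s z≤n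

  square-residue : ∀ k {u} (p : EvenOrOdd u) → 4 ∣ (3 + 4 * k) * (u * u) + oddness p
  square-residue k (even a) = divides ((3 + 4 * k) * (a * a)) (ring k a)
    where
    ring : ∀ k a → (3 + 4 * k) * (2 * a * (2 * a)) + 0 ≡ (3 + 4 * k) * (a * a) * 4
    ring = solve-∀
  square-residue k (odd a) = divides ((3 + 4 * k) * (a * a + a) + k + 1) (ring k a)
    where
    ring : ∀ k a → (3 + 4 * k) * ((1 + 2 * a) * (1 + 2 * a)) + 1 ≡
                   ((3 + 4 * k) * (a * a + a) + k + 1) * 4
    ring = solve-∀

  diagForm-residue : ∀ a b c {u v w} (p : EvenOrOdd u) (q : EvenOrOdd v) (r : EvenOrOdd w) →
    4 ∣ diagForm (3 + 4 * a) (3 + 4 * b) (3 + 4 * c) u v w + (oddness p + oddness q + oddness r)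
  diagForm-residue a b c {u} {v} {w} p q r =
    subst (4 ∣_) (regroup ((3 + 4 * a) * (u * u)) ((3 + 4 * b) * (v * v)) ((3 + 4 * c) * (w * w))
                          (oddness p) (oddness q) (oddness r))
          (∣m∣n⇒∣m+n (∣m∣n⇒∣m+n (square-residue a p) (square-residue b q)) (square-residue c r))
    where
    regroup : ∀ x y z i j k → x + i + (y + j) + (z + k) ≡ x + y + z + (i + j + k)
    regroup = solve-∀

  oddness-sum≤3 : ∀ {u v w} (p : EvenOrOdd u) (q : EvenOrOdd v) (r : EvenOrOdd w) →
                  oddness p + oddness q + oddness r ≤ 3
  oddness-sum≤3 p q r = +-mono-≤ (+-mono-≤ (oddness≤1 p) (oddness≤1 q)) (oddness≤1 r)

  ∣∧<⇒≡0 : ∀ {d n} → d ∣ n → n < d → n ≡ 0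
  ∣∧<⇒≡0 {n = zero}  _   _   = refl
  ∣∧<⇒≡0 {n = suc _} d∣n n<d = ⊥-elim (>⇒∤ n<d d∣n)

  no-odd-coordinate : ∀ a b c {m u v w} (p : EvenOrOdd u) (q : EvenOrOdd v) (r : EvenOrOdd w) →
    diagForm (3 + 4 * a) (3 + 4 * b) (3 + 4 * c) u v w ≡ 4 * m →
    oddness p + oddness q + oddness r ≡ 0
  no-odd-coordinate a b c {m} p q r eq = ∣∧<⇒≡0 4∣s (s≤s (oddness-sum≤3 p q r))
    where
    s : ℕ
    s = oddness p + oddness q + oddness r
    4∣s : 4 ∣ s
    4∣s = ∣m+n∣m⇒∣n (subst (λ Q → 4 ∣ Q + s) eq (diagForm-residue a b c p q r)) (m∣m*n m)

  all-odd-coordinates : ∀ a b c {n u v w} (p : EvenOrOdd u) (q : EvenOrOdd v) (r : EvenOrOdd w) →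
    diagForm (3 + 4 * a) (3 + 4 * b) (3 + 4 * c) u v w ≡ 8 * n + ((3 + 4 * a) + (3 + 4 * b) + (3 + 4 * c)) →
    oddness p + oddness q + oddness r ≡ 3
  all-odd-coordinates a b c {n} p q r eq =
    suc-injective (≤-antisym (s≤s (oddness-sum≤3 p q r)) (∣⇒≤ 4∣1+s))
    where
    s : ℕ
    s = oddness p + oddness q + oddness r
    regroup : ∀ a b c n s → 8 * n + ((3 + 4 * a) + (3 + 4 * b) + (3 + 4 * c)) + s ≡
                           4 * (2 * n + 2 + a + b + c) + suc s
    regroup = solve-∀
    4∣1+s : 4 ∣ suc s
    4∣1+s = ∣m+n∣m⇒∣n (subst (4 ∣_) (trans (cong (_+ s) eq) (regroup a b c n s)) (diagForm-residue a b c p q r))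
                      (m∣m*n (2 * n + 2 + a + b + c))

  quadruple-support : ∀ a b c {m u v w} → diagForm (3 + 4 * a) (3 + 4 * b) (3 + 4 * c) u v w ≡ 4 * m →
                      EvenUpTo m u × EvenUpTo m v × EvenUpTo m w
  quadruple-support a b c {m} {u} {v} {w} eq =
    classify p q r (no-odd-coordinate a b c {m} p q r eq) eq
    where
    p : EvenOrOdd u
    p = evenOrOdd u
    q : EvenOrOdd v
    q = evenOrOdd v
    r : EvenOrOdd w
    r = evenOrOdd w
    A B C : ℕ
    A = 3 + 4 * a
    B = 3 + 4 * b
    C = 3 + 4 * c
    classify : ∀ {u v w} (p : EvenOrOdd u) (q : EvenOrOdd v) (r : EvenOrOdd w) →
      oddness p + oddness q + oddness r ≡ 0 → diagForm A B C u v w ≡ 4 * m →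
      EvenUpTo m u × EvenUpTo m v × EvenUpTo m w
    classify (even x) (even y) (even z) _ eq
      with diagForm-bounds {A} {B} {C} (*-cancelˡ-≡ _ m 4 (trans (sym (diagForm-double A B C x y z)) eq))
    ... | x≤m , y≤m , z≤m = (x , x≤m , refl) , (y , y≤m , refl) , (z , z≤m , refl)
    classify (odd _)  _        _        ()
    classify (even _) (odd _)  _        ()
    classify (even _) (even _) (odd _)  ()

  odd-support : ∀ a b c {n u v w} →
    diagForm (3 + 4 * a) (3 + 4 * b) (3 + 4 * c) u v w ≡ 8 * n + ((3 + 4 * a) + (3 + 4 * b) + (3 + 4 * c)) →
    OddUpTo n u × OddUpTo n v × OddUpTo n w
  odd-support a b c {n} {u} {v} {w} eq =
    classify p q r (all-odd-coordinates a b c {n} p q r eq) eq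
    where
    p : EvenOrOdd u
    p = evenOrOdd u
    q : EvenOrOdd v
    q = evenOrOdd v
    r : EvenOrOdd w
    r = evenOrOdd w
    A B C : ℕ
    A = 3 + 4 * a
    B = 3 + 4 * b
    C = 3 + 4 * c
    classify : ∀ {u v w} (p : EvenOrOdd u) (q : EvenOrOdd v) (r : EvenOrOdd w) →
      oddness p + oddness q + oddness r ≡ 3 → diagForm A B C u v w ≡ 8 * n + (A + B + C) →
      OddUpTo n u × OddUpTo n v × OddUpTo n w
    classify (odd x) (odd y) (odd z) _ eq
      with linForm-bounds {A} {B} {C}
             (*-cancelˡ-≡ _ n 8 (+-cancelʳ-≡ (A + B + C) _ _ (trans (sym (diagForm-odd A B C x y z)) eq)))
    ... | tx≤n , ty≤n , tz≤n = (x , ≤-trans (n≤tri x) tx≤n , refl)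
                             , (y , ≤-trans (n≤tri y) ty≤n , refl)
                             , (z , ≤-trans (n≤tri z) tz≤n , refl)
    classify (even _) (even _) (even _) ()
    classify (even _) (even _) (odd _)  ()
    classify (even _) (odd _)  (even _) ()
    classify (even _) (odd _)  (odd _)  ()
    classify (odd _)  (even _) (even _) ()
    classify (odd _)  (even _) (odd _)  ()
    classify (odd _)  (odd _)  (even _) ()

  N₃≡triple : ∀ a b c m → N₃ a b c m ≡ triple (∑ℤ m) (λ u v w → 1[ diagForm a b c u v w ≡ m ])
  N₃≡triple a b c m = length-filter-triples _ (intRange m)

  T₃≡triple : ∀ a b c n →
    T₃ a b c n ≡ triple (∑ℕ n) (λ x y z → 1[ linForm a b c (tri x) (tri y) (tri z) ≡ n ])
  T₃≡triple a b c n = length-filter-triples _ (natRange n)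

  N₃-quadruple : ∀ a b c m →
    N₃ (3 + 4 * a) (3 + 4 * b) (3 + 4 * c) (4 * m) ≡ N₃ (3 + 4 * a) (3 + 4 * b) (3 + 4 * c) m
  N₃-quadruple a b c zero      = refl
  N₃-quadruple a b c m@(suc k) = begin
    N₃ A B C (4 * m)                         ≡⟨ N₃≡triple A B C (4 * m) ⟩
    triple (∑ℤ (4 * m)) (solutions (4 * m))  ≡⟨ restrict ⟩
    triple evens (solutions (4 * m))         ≡⟨ triple-cong (∑ℤ-ext m) halve ⟩
    triple (∑ℤ m) (solutions m)              ≡⟨ N₃≡triple A B C m ⟨
    N₃ A B C m                               ∎
    where
    A B C : ℕ
    A = 3 + 4 * a
    B = 3 + 4 * b
    C = 3 + 4 * c
    solutions : ℕ → ℕ → ℕ → ℕ → ℕ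
    solutions t u v w = 1[ diagForm A B C u v w ≡ t ]
    evens : Summation ℕ
    evens h = ∑ℤ m (λ x → h (2 * x))
    ring : ∀ k → 4 * suc k ≡ (1 + 2 * suc k) + (1 + 2 * k)
    ring = solve-∀
    1+2m≤4m : 1 + 2 * m ≤ 4 * m
    1+2m≤4m = subst (1 + 2 * m ≤_) (sym (ring k)) (m≤m+n _ _)
    restrict : triple (∑ℤ (4 * m)) (solutions (4 * m)) ≡ triple evens (solutions (4 * m))
    restrict = triple-reduce (EvenUpTo m) (∑ℤ-ext (4 * m)) (λ e → ∑ℤ-ext m (e ∘ (2 *_))) (∑ℤ-zero m)
                             (λ h → ∑ℤ-evens h 1+2m≤4m) (λ _ _ _ → quadruple-support a b c ∘ 1[≡]≢0⇒≡)
    halve : ∀ x y z → solutions (4 * m) (2 * x) (2 * y) (2 * z) ≡ solutions m x y z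
    halve x y z = 1[≡]-cong (*-cancelˡ-≡ _ m 4 ∘ trans (sym (diagForm-double A B C x y z)))
                            (trans (diagForm-double A B C x y z) ∘ cong (4 *_))

  N₃-odd : ∀ a b c n →
    N₃ (3 + 4 * a) (3 + 4 * b) (3 + 4 * c) (8 * n + ((3 + 4 * a) + (3 + 4 * b) + (3 + 4 * c))) ≡
    8 * T₃ (3 + 4 * a) (3 + 4 * b) (3 + 4 * c) n
  N₃-odd a b c n = begin
    N₃ A B C M                                  ≡⟨ N₃≡triple A B C M ⟩
    triple (∑ℤ M) solutions                     ≡⟨ restrict ⟩
    triple odds solutions                       ≡⟨ triple-scale 2 (natRange n) oddSolutions ⟩
    2 * (2 * (2 * triple (∑ℕ n) oddSolutions))  ≡⟨ cong (λ s → 2 * (2 * (2 * s))) oddSolutions≡T₃ ⟩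
    2 * (2 * (2 * T₃ A B C n))                  ≡⟨ eight (T₃ A B C n) ⟩
    8 * T₃ A B C n                              ∎
    where
    A B C : ℕ
    A = 3 + 4 * a
    B = 3 + 4 * b
    C = 3 + 4 * c
    M : ℕ
    M = 8 * n + (A + B + C)
    nthOdd : ℕ → ℕ
    nthOdd x = 1 + 2 * x
    solutions : ℕ → ℕ → ℕ → ℕ
    solutions u v w = 1[ diagForm A B C u v w ≡ M ]
    oddSolutions : ℕ → ℕ → ℕ → ℕ
    oddSolutions x y z = solutions (nthOdd x) (nthOdd y) (nthOdd z)
    odds : Summation ℕ
    odds h = 2 * ∑ℕ n (h ∘ nthOdd)
    ring : ∀ a b c n → 8 * n + ((3 + 4 * a) + (3 + 4 * b) + (3 + 4 * c)) ≡
                      (1 + 2 * n) + (6 * n + 8 + 4 * (a + b + c))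
    ring = solve-∀
    1+2n≤M : 1 + 2 * n ≤ M
    1+2n≤M = subst (1 + 2 * n ≤_) (sym (ring a b c n)) (m≤m+n _ _)
    restrict : triple (∑ℤ M) solutions ≡ triple odds solutions
    restrict = triple-reduce (OddUpTo n) (∑ℤ-ext M)
                             (λ e → cong (2 *_) (sumOver-ext (natRange n) (e ∘ nthOdd))) (cong (2 *_) (∑ℕ-zero n))
                             (λ h → ∑ℤ-odds h 1+2n≤M) (λ _ _ _ → odd-support a b c ∘ 1[≡]≢0⇒≡)
    untriangle : ∀ x y z → oddSolutions x y z ≡ 1[ linForm A B C (tri x) (tri y) (tri z) ≡ n ]
    untriangle x y z =
      1[≡]-cong (λ e → *-cancelˡ-≡ _ n 8 (+-cancelʳ-≡ (A + B + C) _ _ (trans (sym (diagForm-odd A B C x y z)) e)))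
                (λ e → trans (diagForm-odd A B C x y z) (cong (λ t → 8 * t + (A + B + C)) e))
    oddSolutions≡T₃ : triple (∑ℕ n) oddSolutions ≡ T₃ A B C n
    oddSolutions≡T₃ = trans (triple-cong (sumOver-ext (natRange n)) untriangle) (sym (T₃≡triple A B C n))
    eight : ∀ t → 2 * (2 * (2 * t)) ≡ 8 * t
    eight = solve-∀

open import Data.Nat using (ℕ; suc)
import Data.Nat as ℕ
open import Data.Integer using (ℤ; +_; _*_; _-_)
open import Data.Integer.Properties using (pos-*)
open import Data.Integer.Tactic.RingSolver using (solve-∀)
open import Relation.Binary.PropositionalEquality using (_≡_; trans; cong; cong₂; module ≡-Reasoning)
open ≡-Reasoning
open RepresentationCounts using (N₃-odd; N₃-quadruple)

theorem3 : (n : ℕ) → 1 Data.Nat.≤ n →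
    + 16 * + T₃ 3 7 15 n ≡ + 3 * + N₃ 3 7 15 (8 Data.Nat.* n Data.Nat.+ 25) - + N₃ 3 7 15 (4 Data.Nat.* (8 Data.Nat.* n Data.Nat.+ 25))
theorem3 n _ = begin
  + 16 * + T                            ≡⟨ sixteen (+ T) ⟨
  + 3 * (+ 8 * + T) - + 8 * + T         ≡⟨ cong (λ t → + 3 * t - t) (pos-* 8 T) ⟨
  + 3 * + (8 ℕ.* T) - + (8 ℕ.* T)       ≡⟨ cong₂ (λ N N′ → + 3 * + N - + N′) N≡8T (trans N′≡N N≡8T) ⟨
  + 3 * + N₃ 3 7 15 M - + N₃ 3 7 15 (4 ℕ.* M) ∎
  where
  T M : ℕ
  T = T₃ 3 7 15 n
  M = 8 ℕ.* n ℕ.+ 25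
  N≡8T : N₃ 3 7 15 M ≡ 8 ℕ.* T
  N≡8T = N₃-odd 0 1 3 n
  N′≡N : N₃ 3 7 15 (4 ℕ.* M) ≡ N₃ 3 7 15 M
  N′≡N = N₃-quadruple 0 1 3 M
  sixteen : ∀ t → + 3 * (+ 8 * t) - + 8 * t ≡ + 16 * t
  sixteen = solve-∀
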